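{- The set $\{W_{p,q} : p,q\in\mathbb{N},\ p,q\geq 3\}$ is an antichain for the contraction relation.
   Context: Graphs are finite, simple. For $p,q\in\mathbb{N}$, $W_{p,q}$ is the graph obtained from the disjoint union of the edgeless graph $\overline{K}_p$ and the complete bipartite graph $K_{2,q}$ by adding two new non-adjacent vertices, each adjacent to every vertex of that disjoint union. Contracting an edge $\{u,v\}$ means adding a new vertex adjacent to all neighbours of $u$ and $v$ and deleting $u,v$; $H$ is a contraction of $G$ if obtained by a sequence of edge contractions. An antichain is a set of pairwise incomparable elements. -}

module Defs where

open import Data.Nat using (ℕ; _+_; _<ᵇ_)
open import Data.Fin using (Fin; toℕ)
open import Data.Bool using (Bool; true; false; if_then_else_)
open import Data.Product using (_×_; ∃; ∃₂; _,_)
open import Data.Sum using (_⊎_)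
open import Relation.Nullary using (¬_)
open import Relation.Binary.PropositionalEquality using (_≡_; _≢_; refl; sym)
open import Function.Bundles using (_⇔_)

record Graph : Set₁ where
  field
    n      : ℕ
    Adj    : Fin n → Fin n → Set
    symm   : ∀ {x y} → Adj x y → Adj y x
    irrefl : ∀ {x} → ¬ Adj x x
open Graph public

record _≅_ (G H : Graph) : Set where
  field
    to      : Fin (n G) → Fin (n H)
    from    : Fin (n H) → Fin (n G)
    from∘to : ∀ x → from (to x) ≡ x
    to∘from : ∀ y → to (from y) ≡ y
    adj⇔    : ∀ x y → Adj G x y ⇔ Adj H (to x) (to y)

-- H is (isomorphic to) the graph obtained from G by contracting the edge {u,v}:
-- φ identifies u and v to the new vertex and is a bijection on the remaining
-- vertices; two vertices of H are adjacent iff they are distinct and some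
-- vertices of their preimages are adjacent in G.
record ElemContraction (G H : Graph) : Set where
  field
    u v   : Fin (n G)
    uv    : Adj G u v
    φ     : Fin (n G) → Fin (n H)
    surj  : ∀ y → ∃ λ x → φ x ≡ y
    merge : φ u ≡ φ v
    inj   : ∀ x y → φ x ≡ φ y → x ≡ y ⊎ ((x ≡ u ⊎ x ≡ v) × (y ≡ u ⊎ y ≡ v))
    adj   : ∀ x y → Adj H (φ x) (φ y) ⇔
              (φ x ≢ φ y × ∃₂ λ x′ y′ → φ x′ ≡ φ x × φ y′ ≡ φ y × Adj G x′ y′)

data _≼_ (H : Graph) : Graph → Set₁ where
  done : ∀ {G} → G ≅ H → H ≼ G
  step : ∀ {G K} → ElemContraction G K → H ≼ K → H ≼ G

-- Vertices of Fin (p + 2 + q + 2):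
--   0 .. p-1           : the edgeless part  K̄_p            (part a)
--   p, p+1             : the 2-side of K_{2,q}             (part b)
--   p+2 .. p+q+1       : the q-side of K_{2,q}             (part c)
--   p+q+2, p+q+3       : the two non-adjacent apex vertices (part z)
data Part : Set where
  a b c z : Part

part : ℕ → ℕ → ℕ → Part
part p q i =
  if i <ᵇ p then a else
  if i <ᵇ p + 2 then b else
  if i <ᵇ p + 2 + q then c else z

edgeP : Part → Part → Bool
edgeP z z = false
edgeP z _ = true
edgeP _ z = true
edgeP b c = true
edgeP c b = true
edgeP _ _ = false

edgeP-sym : ∀ x y → edgeP x y ≡ edgeP y x
edgeP-sym a a = refl
edgeP-sym a b = refl
edgeP-sym a c = refl
edgeP-sym a z = refl
edgeP-sym b a = refl
edgeP-sym b b = refl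
edgeP-sym b c = refl
edgeP-sym b z = refl
edgeP-sym c a = refl
edgeP-sym c b = refl
edgeP-sym c c = refl
edgeP-sym c z = refl
edgeP-sym z a = refl
edgeP-sym z b = refl
edgeP-sym z c = refl
edgeP-sym z z = refl

edgeP-irr : ∀ x → edgeP x x ≡ false
edgeP-irr a = refl
edgeP-irr b = refl
edgeP-irr c = refl
edgeP-irr z = refl

W : ℕ → ℕ → Graph
W p q = record
  { n      = p + 2 + q + 2
  ; Adj    = λ i j → edgeP (pt i) (pt j) ≡ true
  ; symm   = λ {x} {y} e → Data.Product.proj₁ (trans' (edgeP-sym (pt y) (pt x)) e , e)
  ; irrefl = λ {x} e → false≢true (trans'' (edgeP-irr (pt x)) e)
  }
  where
    pt : Fin (p + 2 + q + 2) → Part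
    pt i = part p q (toℕ i)
    trans' : ∀ {A : Set} {x y w : A} → x ≡ y → y ≡ w → x ≡ w
    trans' refl e = e
    trans'' : ∀ {A : Set} {x y w : A} → y ≡ x → y ≡ w → x ≡ w
    trans'' refl e = e
    false≢true : ¬ (false ≡ true)
    false≢true ()

module Submission where

-- A contraction of W p q onto W p′ q′ that is not an isomorphism collapses an edge uv
-- to a single vertex w. In W p′ q′ (q′ ≥ 3) every vertex w has a non-neighbour y ≠ w
-- with three distinct neighbours. Each vertex of the fibre over y is adjacent to
-- neither u nor v, and in W p q a common non-neighbour of the ends of an edge lies in
-- the edgeless part K̄_p, whose neighbours are the two apex vertices. So every neighbour
-- of y is the image of one of the two apices, contradicting that y has three.

open import Defs
open import Data.Bool using (true; false)
open import Data.Bool.Properties using (¬-not)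
open import Data.Empty using (⊥; ⊥-elim)
open import Data.Fin using (Fin; toℕ; _↑ˡ_; _↑ʳ_; splitAt; inject≤; _≟_)
open import Data.Fin.Patterns using (0F; 1F; 2F)
open import Data.Fin.Properties
  using (toℕ-↑ˡ; toℕ-↑ʳ; ↑ˡ-injective; ↑ʳ-injective; inject≤-injective; toℕ<n; splitAt⁻¹-↑ˡ; splitAt⁻¹-↑ʳ)
open import Data.Nat using (ℕ; _+_; _<_; _≤_; _<ᵇ_)
open import Data.Nat.Properties using (_<?_; ≤⇒≯; ≤-trans; m≤m+n; +-monoʳ-<)
open import Data.Product using (∃; ∃₂; _×_; _,_; proj₂)
open import Data.Sum using (_⊎_; inj₁; inj₂)
open import Function using (_∘_)
open import Function.Bundles using (Equivalence)
open import Relation.Nullary using (¬_; yes; no)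
open import Relation.Nullary.Decidable using (dec-true; dec-false)
open import Relation.Binary.PropositionalEquality
  using (_≡_; _≢_; refl; sym; trans; cong; subst; subst₂; ≢-sym)

-- What a contraction leaves of its vertex map.
record ContractionMap (G H : Graph) : Set where
  field
    map           : Fin (n G) → Fin (n H)
    surjective    : ∀ y → ∃ λ x → map x ≡ y
    adj-preserved : ∀ {x y} → Adj G x y → map x ≢ map y → Adj H (map x) (map y)
    adj-lifted    : ∀ {x′ y′} → Adj H x′ y′ → ∃₂ λ x y → map x ≡ x′ × map y ≡ y′ × Adj G x y
open ContractionMap

≅⇒ContractionMap : ∀ {G H} → G ≅ H → ContractionMap G H
≅⇒ContractionMap {G} {H} iso = record
  { map           = to
  ; surjective    = λ y → from y , to∘from y
  ; adj-preserved = λ {x} {y} xy _ → Equivalence.to (adj⇔ x y) xy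
  ; adj-lifted    = λ {x′} {y′} x′y′ → from x′ , from y′ , to∘from x′ , to∘from y′ ,
      Equivalence.from (adj⇔ (from x′) (from y′))
        (subst₂ (Adj H) (sym (to∘from x′)) (sym (to∘from y′)) x′y′)
  }
  where open _≅_ iso

ElemContraction⇒ContractionMap : ∀ {G H} → ElemContraction G H → ContractionMap G H
ElemContraction⇒ContractionMap {G} {H} e = record
  { map           = φ
  ; surjective    = surj
  ; adj-preserved = λ {x} {y} xy φx≢φy → Equivalence.from (adj x y) (φx≢φy , x , y , refl , refl , xy)
  ; adj-lifted    = lift
  }
  where
  open ElemContraction e
  lift : ∀ {x′ y′} → Adj H x′ y′ → ∃₂ λ x y → φ x ≡ x′ × φ y ≡ y′ × Adj G x y
  lift {x′} {y′} x′y′ with surj x′ | surj y′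
  ... | x , refl | y , refl = proj₂ (Equivalence.to (adj x y) x′y′)

∘-ContractionMap : ∀ {G K H} → ContractionMap K H → ContractionMap G K → ContractionMap G H
∘-ContractionMap {G} {K} {H} g f = record
  { map           = map g ∘ map f
  ; surjective    = surjective∘
  ; adj-preserved = λ xy gfx≢gfy → adj-preserved g (adj-preserved f xy (gfx≢gfy ∘ cong (map g))) gfx≢gfy
  ; adj-lifted    = lifted∘
  }
  where
  surjective∘ : ∀ y → ∃ λ x → map g (map f x) ≡ y
  surjective∘ y with surjective g y
  ... | k , refl with surjective f k
  ...   | x , refl = x , refl
  lifted∘ : ∀ {x′ y′} → Adj H x′ y′ → ∃₂ λ x y → map g (map f x) ≡ x′ × map g (map f y) ≡ y′ × Adj G x y
  lifted∘ {x′} {y′} x′y′ with adj-lifted g x′y′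
  ... | k , l , refl , refl , kl with adj-lifted f kl
  ...   | x , y , refl , refl , xy = x , y , refl , refl , xy

≼⇒ContractionMap : ∀ {G H} → H ≼ G → ContractionMap G H
≼⇒ContractionMap (done iso)  = ≅⇒ContractionMap iso
≼⇒ContractionMap (step e H≼K) = ∘-ContractionMap (≼⇒ContractionMap H≼K) (ElemContraction⇒ContractionMap e)

≼⇒≅⊎collapsed-edge : ∀ {G H} → H ≼ G →
  G ≅ H ⊎ ∃ λ (f : ContractionMap G H) → ∃₂ λ u v → Adj G u v × map f u ≡ map f v
≼⇒≅⊎collapsed-edge (done iso)   = inj₁ iso
≼⇒≅⊎collapsed-edge (step e H≼K) =
  inj₂ (≼⇒ContractionMap (step e H≼K) , u , v , uv , cong (map (≼⇒ContractionMap H≼K)) merge)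
  where open ElemContraction e

record ThreeNeighbours (G : Graph) (y : Fin (n G)) : Set where
  field
    nbr₁ nbr₂ nbr₃ : Fin (n G)
    nbr₁≢nbr₂      : nbr₁ ≢ nbr₂
    nbr₁≢nbr₃      : nbr₁ ≢ nbr₃
    nbr₂≢nbr₃      : nbr₂ ≢ nbr₃
    adj₁           : Adj G y nbr₁
    adj₂           : Adj G y nbr₂
    adj₃           : Adj G y nbr₃

ThreeNeighbours⇒¬covered-by-two : ∀ {G y} → ThreeNeighbours G y →
  ∀ e₀ e₁ → ¬ (∀ m → Adj G y m → m ≡ e₀ ⊎ m ≡ e₁)
ThreeNeighbours⇒¬covered-by-two t e₀ e₁ cover =
  pigeonhole (cover nbr₁ adj₁) (cover nbr₂ adj₂) (cover nbr₃ adj₃)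
  where
  open ThreeNeighbours t
  pigeonhole : nbr₁ ≡ e₀ ⊎ nbr₁ ≡ e₁ → nbr₂ ≡ e₀ ⊎ nbr₂ ≡ e₁ → nbr₃ ≡ e₀ ⊎ nbr₃ ≡ e₁ → ⊥
  pigeonhole (inj₁ p) (inj₁ q) _        = nbr₁≢nbr₂ (trans p (sym q))
  pigeonhole (inj₂ p) (inj₂ q) _        = nbr₁≢nbr₂ (trans p (sym q))
  pigeonhole (inj₁ p) _        (inj₁ r) = nbr₁≢nbr₃ (trans p (sym r))
  pigeonhole (inj₂ p) _        (inj₂ r) = nbr₁≢nbr₃ (trans p (sym r))
  pigeonhole _        (inj₁ q) (inj₁ r) = nbr₂≢nbr₃ (trans q (sym r))
  pigeonhole _        (inj₂ q) (inj₂ r) = nbr₂≢nbr₃ (trans q (sym r))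

module _ {G H : Graph} (f : ContractionMap G H) where

  preimage-of-non-neighbour-¬adj : ∀ {u x y} → ¬ Adj H (map f u) y → y ≢ map f u → map f x ≡ y → ¬ Adj G u x
  preimage-of-non-neighbour-¬adj ¬adj y≢fu refl ux = ¬adj (adj-preserved f ux (≢-sym y≢fu))

  non-neighbour-adj-lifted : ∀ {u v y m} → map f u ≡ map f v → ¬ Adj H (map f u) y → y ≢ map f u →
    Adj H y m → ∃₂ λ x x′ → ¬ Adj G u x × ¬ Adj G v x × Adj G x x′ × map f x′ ≡ m
  non-neighbour-adj-lifted fu≡fv ¬adj y≢fu ym with adj-lifted f ym
  ... | x , x′ , fx≡y , fx′≡m , xx′ =
    x , x′ , preimage-of-non-neighbour-¬adj ¬adj y≢fu fx≡y ,
    preimage-of-non-neighbour-¬adj (subst (λ w → ¬ Adj H w _) fu≡fv ¬adj) (subst (_ ≢_) fu≡fv y≢fu) fx≡y ,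
    xx′ , fx′≡m

<ᵇ-true : ∀ {k m} → k < m → (k <ᵇ m) ≡ true
<ᵇ-true {k} {m} = dec-true (k <? m)

<ᵇ-false : ∀ {k m} → m ≤ k → (k <ᵇ m) ≡ false
<ᵇ-false {k} {m} m≤k = dec-false (k <? m) (≤⇒≯ m≤k)

common-non-neighbour-part≡a : ∀ X Y V → edgeP X Y ≡ true → edgeP X V ≡ false → edgeP Y V ≡ false → V ≡ a
common-non-neighbour-part≡a _ _ a _  _  _  = refl
common-non-neighbour-part≡a c _ b _  () _
common-non-neighbour-part≡a z _ b _  () _
common-non-neighbour-part≡a _ c b _  _  ()
common-non-neighbour-part≡a _ z b _  _  ()
common-non-neighbour-part≡a a a b () _  _
common-non-neighbour-part≡a a b b () _  _
common-non-neighbour-part≡a b a b () _  _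
common-non-neighbour-part≡a b b b () _  _
common-non-neighbour-part≡a b _ c _  () _
common-non-neighbour-part≡a z _ c _  () _
common-non-neighbour-part≡a _ b c _  _  ()
common-non-neighbour-part≡a _ z c _  _  ()
common-non-neighbour-part≡a a a c () _  _
common-non-neighbour-part≡a a c c () _  _
common-non-neighbour-part≡a c a c () _  _
common-non-neighbour-part≡a c c c () _  _
common-non-neighbour-part≡a a _ z _  () _
common-non-neighbour-part≡a b _ z _  () _
common-non-neighbour-part≡a c _ z _  () _
common-non-neighbour-part≡a z a z _  _  ()
common-non-neighbour-part≡a z b z _  _  ()
common-non-neighbour-part≡a z c z _  _  ()
common-non-neighbour-part≡a z z z () _  _

a-neighbour-part≡z : ∀ V → edgeP a V ≡ true → V ≡ z
a-neighbour-part≡z z _ = refl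
a-neighbour-part≡z a ()
a-neighbour-part≡z b ()
a-neighbour-part≡z c ()

module WVertices (p q : ℕ) where

  N : ℕ
  N = p + 2 + q + 2

  pt : Fin N → Part
  pt x = part p q (toℕ x)

  vB : Fin 2 → Fin N
  vB i = ((p ↑ʳ i) ↑ˡ q) ↑ˡ 2

  vC : Fin q → Fin N
  vC i = ((p + 2) ↑ʳ i) ↑ˡ 2

  vZ : Fin 2 → Fin N
  vZ i = (p + 2 + q) ↑ʳ i

  part-b : ∀ {k} → p ≤ k → k < p + 2 → part p q k ≡ b
  part-b p≤k k<p+2 rewrite <ᵇ-false p≤k | <ᵇ-true k<p+2 = refl

  part-c : ∀ {k} → p + 2 ≤ k → k < p + 2 + q → part p q k ≡ c
  part-c p+2≤k k<p+2+q
    rewrite <ᵇ-false (≤-trans (m≤m+n p 2) p+2≤k) | <ᵇ-false p+2≤k | <ᵇ-true k<p+2+q = refl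

  part-z : ∀ {k} → p + 2 + q ≤ k → part p q k ≡ z
  part-z p+2+q≤k
    rewrite <ᵇ-false (≤-trans (m≤m+n p 2) (≤-trans (m≤m+n (p + 2) q) p+2+q≤k))
          | <ᵇ-false (≤-trans (m≤m+n (p + 2) q) p+2+q≤k) | <ᵇ-false p+2+q≤k = refl

  part<p+2+q-≢z : ∀ {k} → k < p + 2 + q → part p q k ≢ z
  part<p+2+q-≢z {k} k<p+2+q with k <ᵇ p | k <ᵇ p + 2
  ... | true  | _    = λ ()
  ... | false | true = λ ()
  ... | false | false rewrite <ᵇ-true k<p+2+q = λ ()

  pt-vB : ∀ i → pt (vB i) ≡ b
  pt-vB i rewrite toℕ-↑ˡ ((p ↑ʳ i) ↑ˡ q) 2 | toℕ-↑ˡ (p ↑ʳ i) q | toℕ-↑ʳ p i =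
    part-b (m≤m+n p _) (+-monoʳ-< p (toℕ<n i))

  pt-vC : ∀ i → pt (vC i) ≡ c
  pt-vC i rewrite toℕ-↑ˡ ((p + 2) ↑ʳ i) 2 | toℕ-↑ʳ (p + 2) i =
    part-c (m≤m+n (p + 2) _) (+-monoʳ-< (p + 2) (toℕ<n i))

  pt-vZ : ∀ i → pt (vZ i) ≡ z
  pt-vZ i rewrite toℕ-↑ʳ (p + 2 + q) i = part-z (m≤m+n (p + 2 + q) _)

  vB-injective : ∀ i j → vB i ≡ vB j → i ≡ j
  vB-injective i j = ↑ʳ-injective p i j ∘ ↑ˡ-injective q _ _ ∘ ↑ˡ-injective 2 _ _

  vC-injective : ∀ i j → vC i ≡ vC j → i ≡ j
  vC-injective i j = ↑ʳ-injective (p + 2) i j ∘ ↑ˡ-injective 2 _ _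

  vZ-injective : ∀ i j → vZ i ≡ vZ j → i ≡ j
  vZ-injective = ↑ʳ-injective (p + 2 + q)

  pt≡z⇒vZ : ∀ x → pt x ≡ z → x ≡ vZ 0F ⊎ x ≡ vZ 1F
  pt≡z⇒vZ x ptx≡z with splitAt (p + 2 + q) x in eq
  ... | inj₁ i  = ⊥-elim (part<p+2+q-≢z (subst (_< p + 2 + q) toℕi≡toℕx (toℕ<n i)) ptx≡z)
    where toℕi≡toℕx : toℕ i ≡ toℕ x
          toℕi≡toℕx = trans (sym (toℕ-↑ˡ i 2)) (cong toℕ (splitAt⁻¹-↑ˡ eq))
  ... | inj₂ 0F = inj₁ (sym (splitAt⁻¹-↑ʳ eq))
  ... | inj₂ 1F = inj₂ (sym (splitAt⁻¹-↑ʳ eq))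

  adj-by-parts : ∀ {x y X Y} → pt x ≡ X → pt y ≡ Y → edgeP X Y ≡ true → Adj (W p q) x y
  adj-by-parts refl refl XY = XY

  same-part-¬adj : ∀ {x y X} → pt x ≡ X → pt y ≡ X → ¬ Adj (W p q) x y
  same-part-¬adj {X = X} refl py xy with () ← trans (sym (edgeP-irr X)) (subst (λ Y → edgeP X Y ≡ true) py xy)

  parts-differ : ∀ {x y X Y} → pt x ≡ X → pt y ≡ Y → X ≢ Y → x ≢ y
  parts-differ refl refl X≢Y refl = X≢Y refl

  common-non-neighbour-adj⇒vZ : ∀ {u v x x′} → Adj (W p q) u v → ¬ Adj (W p q) u x → ¬ Adj (W p q) v x →
    Adj (W p q) x x′ → x′ ≡ vZ 0F ⊎ x′ ≡ vZ 1F
  common-non-neighbour-adj⇒vZ {u} {v} {x} {x′} uv ¬ux ¬vx xx′ =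
    pt≡z⇒vZ x′ (a-neighbour-part≡z (pt x′) (subst (λ X → edgeP X (pt x′) ≡ true) pt-x≡a xx′))
    where pt-x≡a : pt x ≡ a
          pt-x≡a = common-non-neighbour-part≡a (pt u) (pt v) (pt x) uv (¬-not ¬ux) (¬-not ¬vx)

  vC₃ : 3 ≤ q → Fin 3 → Fin N
  vC₃ 3≤q i = vC (inject≤ i 3≤q)

  vC₃-injective : ∀ 3≤q i j → vC₃ 3≤q i ≡ vC₃ 3≤q j → i ≡ j
  vC₃-injective 3≤q i j = inject≤-injective 3≤q 3≤q i j ∘ vC-injective _ _

  three-c-neighbours : 3 ≤ q → ∀ {y X} → pt y ≡ X → edgeP X c ≡ true → ThreeNeighbours (W p q) y
  three-c-neighbours 3≤q py Xc = record
    { nbr₁ = vC₃ 3≤q 0F ; nbr₂ = vC₃ 3≤q 1F ; nbr₃ = vC₃ 3≤q 2F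
    ; nbr₁≢nbr₂ = (λ ()) ∘ vC₃-injective 3≤q 0F 1F
    ; nbr₁≢nbr₃ = (λ ()) ∘ vC₃-injective 3≤q 0F 2F
    ; nbr₂≢nbr₃ = (λ ()) ∘ vC₃-injective 3≤q 1F 2F
    ; adj₁ = adj-by-parts py (pt-vC _) Xc
    ; adj₂ = adj-by-parts py (pt-vC _) Xc
    ; adj₃ = adj-by-parts py (pt-vC _) Xc
    }

  c-vertex-three-neighbours : ∀ {y} → pt y ≡ c → ThreeNeighbours (W p q) y
  c-vertex-three-neighbours py = record
    { nbr₁ = vB 0F ; nbr₂ = vB 1F ; nbr₃ = vZ 0F
    ; nbr₁≢nbr₂ = (λ ()) ∘ vB-injective 0F 1F
    ; nbr₁≢nbr₃ = parts-differ (pt-vB 0F) (pt-vZ 0F) (λ ())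
    ; nbr₂≢nbr₃ = parts-differ (pt-vB 1F) (pt-vZ 0F) (λ ())
    ; adj₁ = adj-by-parts py (pt-vB 0F) refl
    ; adj₂ = adj-by-parts py (pt-vB 1F) refl
    ; adj₃ = adj-by-parts py (pt-vZ 0F) refl
    }

  another-in-part : ∀ {X} v₀ v₁ → v₀ ≢ v₁ → pt v₀ ≡ X → pt v₁ ≡ X → ∀ w → ∃ λ y → y ≢ w × pt y ≡ X
  another-in-part v₀ v₁ v₀≢v₁ pv₀ pv₁ w with w ≟ v₀
  ... | yes refl = v₁ , ≢-sym v₀≢v₁ , pv₁
  ... | no w≢v₀  = v₀ , ≢-sym w≢v₀ , pv₀

  non-neighbour-with-three-neighbours : 3 ≤ q → ∀ w →
    ∃ λ y → y ≢ w × ¬ Adj (W p q) w y × ThreeNeighbours (W p q) y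
  non-neighbour-with-three-neighbours 3≤q w = by-part (pt w) refl
    where
    by-part : ∀ X → pt w ≡ X → ∃ λ y → y ≢ w × ¬ Adj (W p q) w y × ThreeNeighbours (W p q) y
    by-part a pw = vB 0F , parts-differ (pt-vB 0F) pw (λ ()) , ¬wb₀ , three-c-neighbours 3≤q (pt-vB 0F) refl
      where ¬wb₀ : ¬ Adj (W p q) w (vB 0F)
            ¬wb₀ wb₀ with () ← subst₂ (λ X Y → edgeP X Y ≡ true) pw (pt-vB 0F) wb₀
    by-part b pw with y , y≢w , py ← another-in-part (vB 0F) (vB 1F) ((λ ()) ∘ vB-injective 0F 1F) (pt-vB 0F) (pt-vB 1F) w
      = y , y≢w , same-part-¬adj pw py , three-c-neighbours 3≤q py refl
    by-part c pw with y , y≢w , py ← another-in-part (vC₃ 3≤q 0F) (vC₃ 3≤q 1F) ((λ ()) ∘ vC₃-injective 3≤q 0F 1F) (pt-vC _) (pt-vC _) w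
      = y , y≢w , same-part-¬adj pw py , c-vertex-three-neighbours py
    by-part z pw with y , y≢w , py ← another-in-part (vZ 0F) (vZ 1F) ((λ ()) ∘ vZ-injective 0F 1F) (pt-vZ 0F) (pt-vZ 1F) w
      = y , y≢w , same-part-¬adj pw py , three-c-neighbours 3≤q py refl

contraction-onto-W-collapses-no-edge : ∀ p q P Q → 3 ≤ Q → (f : ContractionMap (W p q) (W P Q)) →
  ∀ {u v} → Adj (W p q) u v → map f u ≢ map f v
contraction-onto-W-collapses-no-edge p q P Q 3≤Q f {u} {v} uv fu≡fv
  with y , y≢fu , ¬fu~y , three ← WVertices.non-neighbour-with-three-neighbours P Q 3≤Q (map f u)
  = ThreeNeighbours⇒¬covered-by-two three (map f (vZ 0F)) (map f (vZ 1F)) covered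
  where
  open WVertices p q using (vZ; common-non-neighbour-adj⇒vZ)
  covered : ∀ m → Adj (W P Q) y m → m ≡ map f (vZ 0F) ⊎ m ≡ map f (vZ 1F)
  covered m ym with x , x′ , ¬ux , ¬vx , xx′ , fx′≡m ← non-neighbour-adj-lifted f fu≡fv ¬fu~y y≢fu ym
    with common-non-neighbour-adj⇒vZ uv ¬ux ¬vx xx′
  ... | inj₁ refl = inj₁ (sym fx′≡m)
  ... | inj₂ refl = inj₂ (sym fx′≡m)

corollary3 : ∀ p q p′ q′ → 3 ≤ p → 3 ≤ q → 3 ≤ p′ → 3 ≤ q′ →
    W p′ q′ ≼ W p q → W p q ≅ W p′ q′
corollary3 p q p′ q′ _ _ _ 3≤q′ W′≼W with ≼⇒≅⊎collapsed-edge W′≼W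
... | inj₁ iso                        = iso
... | inj₂ (f , u , v , uv , fu≡fv) = ⊥-elim (contraction-onto-W-collapses-no-edge p q p′ q′ 3≤q′ f uv fu≡fv)
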